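{- Let $A\in\mathbb{F}_2[x]$ be special and perfect. Then $$A=\sum_{D\mid A}\sigma^*(D).$$
   Context: $\sigma(A)$ is the sum of all divisors of $A$ in $\mathbb{F}_2[x]$; $A$ is perfect if $\sigma(A)=A$. A divisor $D$ of $A$ is unitary if $\gcd(D,A/D)=1$, and $\sigma^*(A)$ is the sum of all unitary divisors of $A$. $A$ is special if $A=S^2$ for some square-free $S\in\mathbb{F}_2[x]$ (a notion used for odd perfect polynomials, i.e. perfect polynomials with no irreducible factor of degree $1$). Sums over $D\mid A$ run over all divisors of $A$ in $\mathbb{F}_2[x]$. -}

module Defs where

open import Data.Bool using (Bool; true; false; _xor_; _∧_; not; if_then_else_)
open import Data.Bool.Properties using () renaming (_≟_ to _≟B_)
open import Data.Nat using (ℕ; zero; suc; _≤_; _≤ᵇ_)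
open import Data.List using (List; []; _∷_; length; filterᵇ; map; foldr; _++_)
open import Data.Bool.ListAction using (any)
open import Data.List.Properties using (≡-dec)
open import Data.Product using (∃)
open import Relation.Nullary using (¬_; does)
open import Relation.Binary.PropositionalEquality using (_≡_)

-- Polynomials over F₂ as coefficient lists, lowest degree first.
-- Representations are compared up to trailing zero coefficients.

Poly : Set
Poly = List Bool

norm : Poly → Poly
norm [] = []
norm (b ∷ p) with norm p
... | [] = if b then true ∷ [] else []
... | q@(_ ∷ _) = b ∷ q

_≈_ : Poly → Poly → Set
p ≈ q = norm p ≡ norm q

_≈ᵇ_ : Poly → Poly → Bool
p ≈ᵇ q = does (≡-dec _≟B_ (norm p) (norm q))

_⊕_ : Poly → Poly → Poly
[] ⊕ q = q
(a ∷ p) ⊕ [] = a ∷ p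
(a ∷ p) ⊕ (b ∷ q) = (a xor b) ∷ (p ⊕ q)

_⊗_ : Poly → Poly → Poly
[] ⊗ q = []
(b ∷ p) ⊗ q = (if b then q else []) ⊕ (false ∷ (p ⊗ q))

-- the number of coefficients of the canonical form (= degree + 1, and 0 for 0)
len : Poly → ℕ
len p = length (norm p)

nonzeroᵇ : Poly → Bool
nonzeroᵇ p = not (p ≈ᵇ [])

nonconstᵇ : Poly → Bool
nonconstᵇ p = 2 ≤ᵇ len p

-- all coefficient lists of length n (every polynomial of degree < n appears
-- exactly once up to ≈)
lists : ℕ → List Poly
lists zero = [] ∷ []
lists (suc n) = map (false ∷_) (lists n) ++ map (true ∷_) (lists n)

_∣_ : Poly → Poly → Set
D ∣ A = ∃ λ Q → (Q ⊗ D) ≈ A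

-- for nonzero A, any quotient Q with Q ⊗ D ≈ A has degree ≤ deg A,
-- so searching quotients among lists (len A) is exhaustive
divᵇ : Poly → Poly → Bool
divᵇ D A = any (λ Q → (Q ⊗ D) ≈ᵇ A) (lists (len A))

-- the list of all (nonzero) divisors of a nonzero A, each exactly once
divisors : Poly → List Poly
divisors A = filterᵇ (λ D → nonzeroᵇ D ∧ divᵇ D A) (map norm (lists (len A)))

sumP : List Poly → Poly
sumP = foldr _⊕_ []

σ : Poly → Poly
σ A = sumP (divisors A)

Perfect : Poly → Set
Perfect A = σ A ≈ A

-- E and F are coprime (gcd = 1) for E nonzero: no nonconstant common divisor
coprimeᵇ : Poly → Poly → Bool
coprimeᵇ E F = not (any (λ C → nonconstᵇ C ∧ (divᵇ C E ∧ divᵇ C F)) (lists (len E)))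

unitaryᵇ : Poly → Poly → Bool
unitaryᵇ D A = any (λ Q → ((Q ⊗ D) ≈ᵇ A) ∧ coprimeᵇ D Q) (lists (len A))

σ* : Poly → Poly
σ* A = sumP (filterᵇ (λ D → unitaryᵇ D A) (divisors A))

SquareFree : Poly → Set
SquareFree S = ¬ (S ≈ []) × (∀ P → 2 ≤ len P → ¬ ((P ⊗ P) ∣ S))
  where open import Data.Product using (_×_)

Special : Poly → Set
Special A = ∃ λ S → SquareFree S × (A ≈ (S ⊗ S))
  where open import Data.Product using (_×_)

-- Expanding σ*(D) as the sum of the unitary divisors E of D and exchanging the two sums gives
-- Σ_{D ∣ A} σ*(D) = Σ_{E ∣ A} N(E) · E, where N(E) counts the divisors D of A of which E is a
-- unitary divisor.  Write A = S² with S square-free, g = gcd(E, S) and S = T g.  Square-freeness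
-- makes E coprime to T, so E ∣ g² and D ↦ D / E is a bijection onto the divisors of T².  The
-- involution F ↦ T² / F on these has the single fixed point T, so N(E) is odd; in characteristic 2
-- the sum is therefore Σ_{E ∣ A} E = σ(A), which is A as A is perfect.
module Submission where

open import Defs
open import Algebra.Bundles using (CommutativeMonoid; CommutativeSemigroup)
import Algebra.Properties.CommutativeSemigroup as CommSemigroupProperties
open import Data.Bool using (Bool; true; false; _xor_; _∧_; if_then_else_; T)
open import Data.Unit using (tt)
open import Data.Bool.Properties
  using (xor-assoc; xor-comm; xor-same; xor-identityʳ; T-∧; T-not-≡; T-≡)
  renaming (_≟_ to _≟B_)
open import Data.List using (List; []; _∷_; length; map; filter; filterᵇ; _++_; replicate)
open import Data.List.Properties
  using (≡-dec; map-++; map-∘; map-cong; map-id; length-map; length-++; length-replicate)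
open import Data.List.Membership.Propositional using (_∈_; lose)
open import Data.List.Membership.Propositional.Properties
  using (∈-map⁺; ∈-map⁻; ∈-++⁺ˡ; ∈-++⁺ʳ; ∈-++⁻; ∈-filter⁺; ∈-filter⁻)
open import Data.List.Relation.Unary.Any using (here; there; satisfied; any?)
open import Data.List.Relation.Unary.Any.Properties using (any⁺; any⁻)
open import Data.List.Relation.Unary.Unique.Propositional using (Unique)
import Data.List.Relation.Unary.Unique.Propositional.Properties as Unique
import Data.List.Relation.Unary.AllPairs as AllPairs
import Data.List.Relation.Unary.All as All
open import Data.List.Relation.Unary.All.Properties using (all-filter) renaming (map⁺ to All-map⁺)
open import Data.List.Relation.Binary.Permutation.Propositional using (_↭_; ↭⇒↭ₛ)
open import Data.List.Relation.Binary.Permutation.Propositional.Properties using (↭-length)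
import Data.List.Relation.Binary.Permutation.Setoid.Properties as PermutationProperties
open import Data.List.Relation.Binary.BagAndSetEquality using (∼bag⇒↭)
open import Data.List.Membership.Propositional.Properties.WithK using (unique∧set⇒bag)
open import Data.Bool.ListAction using (any)
open import Data.Nat using (ℕ; zero; suc; pred; _+_; _%_; _≤_; _<_; _∸_; z≤n; s≤s)
open import Data.Nat.Properties
open import Data.Nat.DivMod using (%-distribˡ-+)
open import Data.Product using (_×_; _,_; proj₁; proj₂; ∃)
open import Data.Sum using (inj₁; inj₂)
open import Data.Empty using (⊥; ⊥-elim)
open import Function using (_∘_; Equivalence; mk⇔; case_of_)
open import Relation.Nullary using (¬_; ¬?; yes; no; contradiction)
open import Relation.Nullary.Decidable.Core using (T?)
open import Relation.Binary using (Setoid; Decidable; DecidableEquality)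
open import Relation.Binary.PropositionalEquality
import Relation.Binary.Reasoning.Setoid as SetoidReasoning

-- Arithmetic in F₂[x]

consₙ : Bool → Poly → Poly
consₙ b [] = if b then true ∷ [] else []
consₙ b (x ∷ q) = b ∷ x ∷ q

norm-∷ : ∀ b p → norm (b ∷ p) ≡ consₙ b (norm p)
norm-∷ b p with norm p
... | [] = refl
... | _ ∷ _ = refl

coeff : Poly → ℕ → Bool
coeff [] _ = false
coeff (b ∷ p) zero = b
coeff (b ∷ p) (suc i) = coeff p i

coeff-consₙ : ∀ b r i → coeff (consₙ b r) i ≡ coeff (b ∷ r) i
coeff-consₙ true [] zero = refl
coeff-consₙ true [] (suc i) = refl
coeff-consₙ false [] zero = refl
coeff-consₙ false [] (suc i) = refl
coeff-consₙ b (x ∷ r) i = refl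

coeff-norm : ∀ p i → coeff (norm p) i ≡ coeff p i
coeff-norm [] i = refl
coeff-norm (b ∷ p) i rewrite norm-∷ b p = trans (coeff-consₙ b (norm p) i) (tail-case i)
  where
  tail-case : ∀ i → coeff (b ∷ norm p) i ≡ coeff (b ∷ p) i
  tail-case zero = refl
  tail-case (suc i) = coeff-norm p i

-- Defs' _≈_ unfolds to an equation between normal forms, from which Agda cannot
-- recover p and q; the record keeps them visible to unification.
infix 4 _≃_ _≄_
record _≃_ (p q : Poly) : Set where
  constructor mk≃
  field norm-≡ : norm p ≡ norm q
open _≃_ public

_≄_ : Poly → Poly → Set
p ≄ q = ¬ (p ≃ q)

≃-refl : ∀ {p} → p ≃ p
≃-refl = mk≃ refl

≃-sym : ∀ {p q} → p ≃ q → q ≃ p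
≃-sym (mk≃ e) = mk≃ (sym e)

≃-trans : ∀ {p q r} → p ≃ q → q ≃ r → p ≃ r
≃-trans (mk≃ e) (mk≃ f) = mk≃ (trans e f)

≡⇒≃ : ∀ {p q} → p ≡ q → p ≃ q
≡⇒≃ refl = ≃-refl

≃-setoid : Setoid _ _
≃-setoid = record
  { Carrier = Poly ; _≈_ = _≃_
  ; isEquivalence = record { refl = ≃-refl ; sym = ≃-sym ; trans = ≃-trans } }

_≃?_ : Decidable _≃_
p ≃? q with ≡-dec _≟B_ (norm p) (norm q)
... | yes e = yes (mk≃ e)
... | no ne = no (ne ∘ norm-≡)

≃-ext : ∀ {p q} → (∀ i → coeff p i ≡ coeff q i) → p ≃ q
≃-ext {p} {q} h = mk≃ (norms-agree p q h)
  where
  norms-agree : ∀ p q → (∀ i → coeff p i ≡ coeff q i) → norm p ≡ norm q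
  norms-agree [] [] h = refl
  norms-agree [] (b ∷ q) h rewrite norm-∷ b q | sym (h zero) | sym (norms-agree [] q (h ∘ suc)) = refl
  norms-agree (a ∷ p) [] h rewrite norm-∷ a p | h zero | norms-agree p [] (h ∘ suc) = refl
  norms-agree (a ∷ p) (b ∷ q) h rewrite norm-∷ a p | norm-∷ b q | h zero | norms-agree p q (h ∘ suc) = refl

≃-coeff : ∀ {p q} → p ≃ q → ∀ i → coeff p i ≡ coeff q i
≃-coeff {p} {q} (mk≃ e) i =
  trans (sym (coeff-norm p i)) (trans (cong (λ r → coeff r i) e) (coeff-norm q i))

norm-≃ : ∀ p → norm p ≃ p
norm-≃ p = ≃-ext (coeff-norm p)

norm-idem : ∀ p → norm (norm p) ≡ norm p
norm-idem p = norm-≡ (norm-≃ p)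

≃-normal⇒≡ : ∀ {p q} → norm p ≡ p → norm q ≡ q → p ≃ q → p ≡ q
≃-normal⇒≡ np nq e = trans (sym np) (trans (norm-≡ e) nq)

∷-cong : ∀ b {p q} → p ≃ q → (b ∷ p) ≃ (b ∷ q)
∷-cong b = ≃-ext ∘ coeffs
  where
  coeffs : ∀ {p q} → p ≃ q → ∀ i → coeff (b ∷ p) i ≡ coeff (b ∷ q) i
  coeffs e zero = refl
  coeffs e (suc i) = ≃-coeff e i

∷-injective : ∀ {a b p q} → (a ∷ p) ≃ (b ∷ q) → (a ≡ b) × (p ≃ q)
∷-injective e = ≃-coeff e zero , ≃-ext (≃-coeff e ∘ suc)

[]≃false∷ : ∀ {q} → [] ≃ q → [] ≃ (false ∷ q)
[]≃false∷ e = ≃-trans (mk≃ refl) (∷-cong false e)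

coeff-⊕ : ∀ p q i → coeff (p ⊕ q) i ≡ coeff p i xor coeff q i
coeff-⊕ [] q i = refl
coeff-⊕ (a ∷ p) [] i = sym (xor-identityʳ _)
coeff-⊕ (a ∷ p) (b ∷ q) zero = refl
coeff-⊕ (a ∷ p) (b ∷ q) (suc i) = coeff-⊕ p q i

⊕-cong : ∀ {p p′ q q′} → p ≃ p′ → q ≃ q′ → (p ⊕ q) ≃ (p′ ⊕ q′)
⊕-cong {p} {p′} {q} {q′} e f = ≃-ext λ i →
  trans (coeff-⊕ p q i) (trans (cong₂ _xor_ (≃-coeff e i) (≃-coeff f i)) (sym (coeff-⊕ p′ q′ i)))

⊕-comm : ∀ p q → p ⊕ q ≡ q ⊕ p
⊕-comm [] [] = refl
⊕-comm [] (b ∷ q) = refl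
⊕-comm (a ∷ p) [] = refl
⊕-comm (a ∷ p) (b ∷ q) = cong₂ _∷_ (xor-comm a b) (⊕-comm p q)

⊕-assoc : ∀ p q r → (p ⊕ q) ⊕ r ≡ p ⊕ (q ⊕ r)
⊕-assoc [] q r = refl
⊕-assoc (a ∷ p) [] r = refl
⊕-assoc (a ∷ p) (b ∷ q) [] = refl
⊕-assoc (a ∷ p) (b ∷ q) (c ∷ r) = cong₂ _∷_ (xor-assoc a b c) (⊕-assoc p q r)

⊕-identityʳ : ∀ p → p ⊕ [] ≡ p
⊕-identityʳ [] = refl
⊕-identityʳ (a ∷ p) = refl

⊕-self : ∀ p → (p ⊕ p) ≃ []
⊕-self p = ≃-ext λ i → trans (coeff-⊕ p p i) (xor-same (coeff p i))

⊕≃[]⇒≃ : ∀ {p q} → (p ⊕ q) ≃ [] → p ≃ q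
⊕≃[]⇒≃ {p} {q} e = ≃-ext λ i →
  xor≡false (coeff p i) (coeff q i) (trans (sym (coeff-⊕ p q i)) (≃-coeff e i))
  where
  xor≡false : ∀ a b → a xor b ≡ false → a ≡ b
  xor≡false false false _ = refl
  xor≡false true true _ = refl

≃⇒⊕≃[] : ∀ {p q} → p ≃ q → (p ⊕ q) ≃ []
≃⇒⊕≃[] {p} {q} e = ≃-trans (⊕-cong e ≃-refl) (⊕-self q)

⊕-cancelʳ : ∀ p q → ((p ⊕ q) ⊕ q) ≃ p
⊕-cancelʳ p q = ≃-trans (≡⇒≃ (⊕-assoc p q q))
  (≃-trans (⊕-cong (≃-refl {p}) (⊕-self q)) (≡⇒≃ (⊕-identityʳ p)))

⊕-commutativeMonoid : CommutativeMonoid _ _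
⊕-commutativeMonoid = record
  { Carrier = Poly ; _≈_ = _≡_ ; _∙_ = _⊕_ ; ε = []
  ; isCommutativeMonoid = record
    { isMonoid = record
      { isSemigroup = record
        { isMagma = record { isEquivalence = isEquivalence ; ∙-cong = cong₂ _⊕_ }
        ; assoc = ⊕-assoc }
      ; identity = (λ _ → refl) , ⊕-identityʳ }
    ; comm = ⊕-comm } }

module ⊕-Props = CommSemigroupProperties (CommutativeMonoid.commutativeSemigroup ⊕-commutativeMonoid)

⊕-interchange : ∀ a b c d → (a ⊕ b) ⊕ (c ⊕ d) ≡ (a ⊕ c) ⊕ (b ⊕ d)
⊕-interchange = ⊕-Props.interchange

one : Poly
one = true ∷ []

scale : Bool → Poly → Poly
scale b q = if b then q else []

scale-cong : ∀ b {q q′} → q ≃ q′ → scale b q ≃ scale b q′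
scale-cong true e = e
scale-cong false e = ≃-refl

scale-xor : ∀ a b q → scale (a xor b) q ≃ (scale a q ⊕ scale b q)
scale-xor false false q = ≃-refl
scale-xor false true q = ≃-refl
scale-xor true false q = ≡⇒≃ (sym (⊕-identityʳ q))
scale-xor true true q = ≃-sym (⊕-self q)

scale-⊕ : ∀ b q q′ → scale b (q ⊕ q′) ≡ (scale b q ⊕ scale b q′)
scale-⊕ true q q′ = refl
scale-⊕ false q q′ = refl

scale-⊗ : ∀ b q r → (scale b q ⊗ r) ≡ scale b (q ⊗ r)
scale-⊗ true q r = refl
scale-⊗ false q r = refl

⊗-zeroʳ : ∀ p → (p ⊗ []) ≃ []
⊗-zeroʳ [] = ≃-refl
⊗-zeroʳ (true ∷ p) = ≃-sym ([]≃false∷ (≃-sym (⊗-zeroʳ p)))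
⊗-zeroʳ (false ∷ p) = ≃-sym ([]≃false∷ (≃-sym (⊗-zeroʳ p)))

⊗-congʳ : ∀ p {q q′} → q ≃ q′ → (p ⊗ q) ≃ (p ⊗ q′)
⊗-congʳ [] e = ≃-refl
⊗-congʳ (b ∷ p) e = ⊕-cong (scale-cong b e) (∷-cong false (⊗-congʳ p e))

⊗-zeroˡ : ∀ {z} q → z ≃ [] → (z ⊗ q) ≃ []
⊗-zeroˡ {[]} q e = ≃-refl
⊗-zeroˡ {b ∷ z} q e with ∷-injective (≃-trans e ([]≃false∷ ≃-refl))
... | refl , z≃[] = ≃-sym ([]≃false∷ (≃-sym (⊗-zeroˡ q z≃[])))

⊗-congˡ : ∀ {p p′} q → p ≃ p′ → (p ⊗ q) ≃ (p′ ⊗ q)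
⊗-congˡ {[]} q e = ≃-sym (⊗-zeroˡ q (≃-sym e))
⊗-congˡ {b ∷ p} {[]} q e = ⊗-zeroˡ q e
⊗-congˡ {a ∷ p} {b ∷ p′} q e with ∷-injective e
... | refl , e′ = ⊕-cong (≃-refl {scale a q}) (∷-cong false (⊗-congˡ q e′))

⊗-cong : ∀ {p p′ q q′} → p ≃ p′ → q ≃ q′ → (p ⊗ q) ≃ (p′ ⊗ q′)
⊗-cong {p′ = p′} {q = q} e f = ≃-trans (⊗-congˡ q e) (⊗-congʳ p′ f)

⊗-distribʳ : ∀ p p′ q → ((p ⊕ p′) ⊗ q) ≃ ((p ⊗ q) ⊕ (p′ ⊗ q))
⊗-distribʳ [] p′ q = ≃-refl
⊗-distribʳ (a ∷ p) [] q = ≡⇒≃ (sym (⊕-identityʳ _))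
⊗-distribʳ (a ∷ p) (b ∷ p′) q =
  ≃-trans (⊕-cong (scale-xor a b q) (∷-cong false (⊗-distribʳ p p′ q)))
          (≡⇒≃ (⊕-interchange (scale a q) (scale b q) (false ∷ (p ⊗ q)) (false ∷ (p′ ⊗ q))))

⊗-distribˡ : ∀ p q q′ → (p ⊗ (q ⊕ q′)) ≃ ((p ⊗ q) ⊕ (p ⊗ q′))
⊗-distribˡ [] q q′ = ≃-refl
⊗-distribˡ (b ∷ p) q q′ =
  ≃-trans (⊕-cong (≡⇒≃ (scale-⊕ b q q′)) (∷-cong false (⊗-distribˡ p q q′)))
          (≡⇒≃ (⊕-interchange (scale b q) (scale b q′) (false ∷ (p ⊗ q)) (false ∷ (p ⊗ q′))))

⊗-∷ʳ : ∀ p b q → (p ⊗ (b ∷ q)) ≃ (scale b p ⊕ (false ∷ (p ⊗ q)))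
⊗-∷ʳ [] false q = mk≃ refl
⊗-∷ʳ [] true q = mk≃ refl
⊗-∷ʳ (false ∷ p) false q = ∷-cong false (⊗-∷ʳ p false q)
⊗-∷ʳ (false ∷ p) true q = ∷-cong false (⊗-∷ʳ p true q)
⊗-∷ʳ (true ∷ p) false q = ∷-cong false (⊕-cong (≃-refl {q}) (⊗-∷ʳ p false q))
⊗-∷ʳ (true ∷ p) true q = ∷-cong true
  (≃-trans (⊕-cong (≃-refl {q}) (⊗-∷ʳ p true q)) (≡⇒≃ (⊕-Props.x∙yz≈y∙xz q p (false ∷ (p ⊗ q)))))

⊗-comm : ∀ p q → (p ⊗ q) ≃ (q ⊗ p)
⊗-comm [] q = ≃-sym (⊗-zeroʳ q)
⊗-comm (b ∷ p) q =
  ≃-trans (⊕-cong (≃-refl {scale b q}) (∷-cong false (⊗-comm p q))) (≃-sym (⊗-∷ʳ q b p))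

⊗-assoc : ∀ p q r → ((p ⊗ q) ⊗ r) ≃ (p ⊗ (q ⊗ r))
⊗-assoc [] q r = ≃-refl
⊗-assoc (b ∷ p) q r =
  ≃-trans (⊗-distribʳ (scale b q) (false ∷ (p ⊗ q)) r)
          (⊕-cong (≡⇒≃ (scale-⊗ b q r)) (∷-cong false (⊗-assoc p q r)))

⊗-identityˡ : ∀ q → (one ⊗ q) ≃ q
⊗-identityˡ q = ≃-trans (⊕-cong (≃-refl {q}) (≃-sym ([]≃false∷ (⊗-zeroˡ q ≃-refl))))
                        (≡⇒≃ (⊕-identityʳ q))

⊗-commutativeSemigroup : CommutativeSemigroup _ _
⊗-commutativeSemigroup = record
  { Carrier = Poly ; _≈_ = _≃_ ; _∙_ = _⊗_
  ; isCommutativeSemigroup = record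
    { isSemigroup = record
      { isMagma = record
        { isEquivalence = Setoid.isEquivalence ≃-setoid ; ∙-cong = ⊗-cong }
      ; assoc = ⊗-assoc }
    ; comm = ⊗-comm } }

module ⊗-Props = CommSemigroupProperties ⊗-commutativeSemigroup

⊗-interchange : ∀ a b c d → ((a ⊗ b) ⊗ (c ⊗ d)) ≃ ((a ⊗ c) ⊗ (b ⊗ d))
⊗-interchange = ⊗-Props.interchange

square-⊕ : ∀ x y → ((x ⊕ y) ⊗ (x ⊕ y)) ≃ ((x ⊗ x) ⊕ (y ⊗ y))
square-⊕ x y = begin
  (x ⊕ y) ⊗ (x ⊕ y)                       ≈⟨ ⊗-distribʳ x y (x ⊕ y) ⟩
  (x ⊗ (x ⊕ y)) ⊕ (y ⊗ (x ⊕ y))           ≈⟨ ⊕-cong (⊗-distribˡ x x y) (⊗-distribˡ y x y) ⟩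
  ((x ⊗ x) ⊕ (x ⊗ y)) ⊕ ((y ⊗ x) ⊕ (y ⊗ y))
    ≈⟨ ⊕-cong (≃-refl {(x ⊗ x) ⊕ (x ⊗ y)}) (⊕-cong (⊗-comm y x) (≃-refl {y ⊗ y})) ⟩
  ((x ⊗ x) ⊕ (x ⊗ y)) ⊕ ((x ⊗ y) ⊕ (y ⊗ y))
    ≈⟨ ≡⇒≃ (trans (cong (((x ⊗ x) ⊕ (x ⊗ y)) ⊕_) (⊕-comm (x ⊗ y) (y ⊗ y)))
                  (⊕-interchange (x ⊗ x) (x ⊗ y) (y ⊗ y) (x ⊗ y))) ⟩
  ((x ⊗ x) ⊕ (y ⊗ y)) ⊕ ((x ⊗ y) ⊕ (x ⊗ y))
    ≈⟨ ⊕-cong (≃-refl {(x ⊗ x) ⊕ (y ⊗ y)}) (⊕-self (x ⊗ y)) ⟩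
  ((x ⊗ x) ⊕ (y ⊗ y)) ⊕ []                ≡⟨ ⊕-identityʳ _ ⟩
  (x ⊗ x) ⊕ (y ⊗ y)                       ∎
  where open SetoidReasoning ≃-setoid

-- Degree

coeff-≥len : ∀ p i → len p ≤ i → coeff p i ≡ false
coeff-≥len p i h = trans (sym (coeff-norm p i)) (beyond (norm p) i h)
  where
  beyond : ∀ q i → length q ≤ i → coeff q i ≡ false
  beyond [] i _ = refl
  beyond (b ∷ q) (suc i) (s≤s h) = beyond q i h

coeff-leading : ∀ p k → len p ≡ suc k → coeff p k ≡ true
coeff-leading (b ∷ p) k h rewrite norm-∷ b p with norm p in eq | b
... | [] | true with refl ← h = refl
coeff-leading (b ∷ p) (suc k) h | x ∷ q | _ = coeff-leading p k (trans (cong length eq) (suc-injective h))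

len-≤ : ∀ p n → (∀ i → n ≤ i → coeff p i ≡ false) → len p ≤ n
len-≤ p n h with len p in eq
... | zero = z≤n
... | suc k with k <? n
...   | yes k<n = k<n
...   | no k≮n with () ← trans (sym (coeff-leading p k eq)) (h k (≮⇒≥ k≮n))

len-cong : ∀ {p q} → p ≃ q → len p ≡ len q
len-cong (mk≃ e) = cong length e

≄[]⇒len≡suc : ∀ {p} → p ≄ [] → ∃ λ k → len p ≡ suc k
≄[]⇒len≡suc {p} p≄[] with norm p in eq
... | [] = ⊥-elim (p≄[] (mk≃ eq))
... | x ∷ q = length q , refl

len-pos⇒≄[] : ∀ {p} → 1 ≤ len p → p ≄ []
len-pos⇒≄[] h e with () ← subst (1 ≤_) (len-cong e) h

len-∷ : ∀ b p → p ≄ [] → len (b ∷ p) ≡ suc (len p)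
len-∷ b p p≄[] with norm p in eq
... | [] = ⊥-elim (p≄[] (mk≃ eq))
... | x ∷ q = refl

len-scale : ∀ b q → len (scale b q) ≤ len q
len-scale true q = ≤-refl
len-scale false q = z≤n

len-⊕-< : ∀ x y → len x < len y → len (x ⊕ y) ≡ len y
len-⊕-< x y x<y with len y in eq
... | suc k = ≤-antisym (len-≤ (x ⊕ y) (suc k) vanishes) (≮⇒≥ λ lt → true≢false (begin
  true                   ≡⟨ sym (cong₂ _xor_ (coeff-≥len x k (≤-pred x<y)) (coeff-leading y k eq)) ⟩
  coeff x k xor coeff y k ≡⟨ sym (coeff-⊕ x y k) ⟩
  coeff (x ⊕ y) k        ≡⟨ coeff-≥len (x ⊕ y) k (≤-pred lt) ⟩
  false                  ∎))
  where
  open ≡-Reasoning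
  true≢false : true ≢ false
  true≢false ()
  vanishes : ∀ i → suc k ≤ i → coeff (x ⊕ y) i ≡ false
  vanishes i h = trans (coeff-⊕ x y i)
    (cong₂ _xor_ (coeff-≥len x i (≤-trans (<⇒≤ x<y) h)) (coeff-≥len y i (subst (_≤ i) (sym eq) h)))

len-⊕-same : ∀ x y k → len x ≡ suc k → len y ≡ suc k → len (x ⊕ y) ≤ k
len-⊕-same x y k lx ly = len-≤ (x ⊕ y) k λ i h → trans (coeff-⊕ x y i) (vanishes i h)
  where
  vanishes : ∀ i → k ≤ i → coeff x i xor coeff y i ≡ false
  vanishes i h with m≤n⇒m<n∨m≡n h
  ... | inj₁ k<i = cong₂ _xor_ (coeff-≥len x i (subst (_≤ i) (sym lx) k<i))
                               (coeff-≥len y i (subst (_≤ i) (sym ly) k<i))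
  ... | inj₂ refl = cong₂ _xor_ (coeff-leading x k lx) (coeff-leading y k ly)

∷-of-zero : ∀ b {p} → p ≃ [] → (b ∷ p) ≃ scale b one
∷-of-zero false e = ≃-sym ([]≃false∷ (≃-sym e))
∷-of-zero true e = ∷-cong true e

len-⊗ : ∀ p q → p ≄ [] → q ≄ [] → suc (len (p ⊗ q)) ≡ len p + len q
len-⊗ [] q []≄[] _ = ⊥-elim ([]≄[] ≃-refl)
len-⊗ (b ∷ p) q bp≄[] q≄[] with p ≃? []
... | yes p≃[] = constant b bp≄[]
  where
  open ≡-Reasoning
  constant : ∀ b → (b ∷ p) ≄ [] → suc (len ((b ∷ p) ⊗ q)) ≡ len (b ∷ p) + len q
  constant false bp≄[] = ⊥-elim (bp≄[] (∷-of-zero false p≃[]))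
  constant true _ = begin
    suc (len ((true ∷ p) ⊗ q))
      ≡⟨ cong suc (len-cong (≃-trans (⊗-congˡ q (∷-of-zero true p≃[])) (⊗-identityˡ q))) ⟩
    suc (len q)                 ≡⟨ cong (_+ len q) (sym (len-cong (∷-of-zero true p≃[]))) ⟩
    len (true ∷ p) + len q      ∎
... | no p≄[] = begin
  suc (len (scale b q ⊕ (false ∷ (p ⊗ q))))  ≡⟨ cong suc (len-⊕-< (scale b q) _ shorter) ⟩
  suc (len (false ∷ (p ⊗ q)))                ≡⟨ cong suc (len-∷ false (p ⊗ q) pq≄[]) ⟩
  suc (suc (len (p ⊗ q)))                    ≡⟨ cong suc ih ⟩
  suc (len p + len q)                        ≡⟨ cong (_+ len q) (sym (len-∷ b p p≄[])) ⟩
  len (b ∷ p) + len q                        ∎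
  where
  open ≡-Reasoning
  ih = len-⊗ p q p≄[] q≄[]
  len-p-pos : 1 ≤ len p
  len-p-pos with k , e ← ≄[]⇒len≡suc p≄[] = subst (1 ≤_) (sym e) (s≤s z≤n)
  len-q<pq : len q < suc (len (p ⊗ q))
  len-q<pq = subst (len q <_) (sym ih) (+-monoˡ-≤ (len q) len-p-pos)
  pq≄[] : (p ⊗ q) ≄ []
  pq≄[] with k , e ← ≄[]⇒len≡suc q≄[] =
    len-pos⇒≄[] (≤-trans (s≤s z≤n) (≤-pred (subst (_< suc (len (p ⊗ q))) e len-q<pq)))
  shorter : len (scale b q) < len (false ∷ (p ⊗ q))
  shorter = subst (len (scale b q) <_) (sym (len-∷ false (p ⊗ q) pq≄[]))
                  (≤-<-trans (len-scale b q) len-q<pq)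

⊗-≄[] : ∀ {p q} → p ≄ [] → q ≄ [] → (p ⊗ q) ≄ []
⊗-≄[] {p} {q} p≄[] q≄[] pq≃[]
  with a , ea ← ≄[]⇒len≡suc p≄[] | b , eb ← ≄[]⇒len≡suc q≄[] = 1+n≢0 (sym (begin
    0                      ≡⟨ len-cong pq≃[] ⟨
    len (p ⊗ q)            ≡⟨ cong pred (len-⊗ p q p≄[] q≄[]) ⟩
    pred (len p + len q)   ≡⟨ cong pred (cong₂ _+_ ea eb) ⟩
    a + suc b              ≡⟨ +-suc a b ⟩
    suc (a + b)            ∎))
  where open ≡-Reasoning

⊗-cancelʳ : ∀ {x y e} → e ≄ [] → (x ⊗ e) ≃ (y ⊗ e) → x ≃ y
⊗-cancelʳ {x} {y} {e} e≄[] xe≃ye with (x ⊕ y) ≃? []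
... | yes x⊕y≃[] = ⊕≃[]⇒≃ x⊕y≃[]
... | no x⊕y≄[] = ⊥-elim (⊗-≄[] x⊕y≄[] e≄[] (≃-trans (⊗-distribʳ x y e) (≃⇒⊕≃[] xe≃ye)))

square-injective : ∀ {x y} → (x ⊗ x) ≃ (y ⊗ y) → x ≃ y
square-injective {x} {y} xx≃yy with (x ⊕ y) ≃? []
... | yes x⊕y≃[] = ⊕≃[]⇒≃ x⊕y≃[]
... | no x⊕y≄[] = ⊥-elim (⊗-≄[] x⊕y≄[] x⊕y≄[] (≃-trans (square-⊕ x y) (≃⇒⊕≃[] xx≃yy)))

≃one : ∀ {g} → g ≄ [] → len g ≤ 1 → g ≃ one
≃one {g} g≄[] h with ≄[]⇒len≡suc g≄[]
... | k , e with refl ← ≤-antisym (≤-pred (subst (_≤ 1) e h)) z≤n = ≃-ext coeffs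
  where
  coeffs : ∀ i → coeff g i ≡ coeff one i
  coeffs zero = coeff-leading g 0 e
  coeffs (suc i) = coeff-≥len g (suc i) (subst (_≤ suc i) (sym e) (s≤s z≤n))

-- Divisibility, coprimality and greatest common divisors

infix 4 _∣ₚ_
record _∣ₚ_ (d a : Poly) : Set where
  constructor divides
  field
    quotient : Poly
    equation : (quotient ⊗ d) ≃ a
open _∣ₚ_ public

∣ₚ-refl : ∀ d → d ∣ₚ d
∣ₚ-refl d = divides one (⊗-identityˡ d)

∣ₚ-resp : ∀ {d d′ a a′} → d ≃ d′ → a ≃ a′ → d ∣ₚ a → d′ ∣ₚ a′
∣ₚ-resp e f (divides q eq) = divides q (≃-trans (⊗-congʳ q (≃-sym e)) (≃-trans eq f))

∣ₚ-trans : ∀ {a b c} → a ∣ₚ b → b ∣ₚ c → a ∣ₚ c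
∣ₚ-trans {a} (divides q₁ e₁) (divides q₂ e₂) =
  divides (q₂ ⊗ q₁) (≃-trans (⊗-assoc q₂ q₁ a) (≃-trans (⊗-congʳ q₂ e₁) e₂))

∣ₚ-⊗ˡ : ∀ {a b} c → a ∣ₚ b → a ∣ₚ (c ⊗ b)
∣ₚ-⊗ˡ {a} c (divides q e) = divides (c ⊗ q) (≃-trans (⊗-assoc c q a) (⊗-congʳ c e))

∣ₚ-⊕ : ∀ {a b c} → a ∣ₚ b → a ∣ₚ c → a ∣ₚ (b ⊕ c)
∣ₚ-⊕ {a} (divides q₁ e₁) (divides q₂ e₂) = divides (q₁ ⊕ q₂) (≃-trans (⊗-distribʳ q₁ q₂ a) (⊕-cong e₁ e₂))

⊗-pres-∣ₚ : ∀ {a b c d} → a ∣ₚ b → c ∣ₚ d → (a ⊗ c) ∣ₚ (b ⊗ d)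
⊗-pres-∣ₚ {a} {b} {c} {d} (divides q₁ e₁) (divides q₂ e₂) =
  divides (q₁ ⊗ q₂) (≃-trans (⊗-interchange q₁ q₂ a c) (⊗-cong e₁ e₂))

∣ₚ-≄[] : ∀ {d a} → d ∣ₚ a → a ≄ [] → d ≄ []
∣ₚ-≄[] {d} (divides q e) a≄[] d≃[] = a≄[] (≃-trans (≃-sym e) (≃-trans (⊗-comm q d) (⊗-zeroˡ q d≃[])))

∣ₚ⇒len≤ : ∀ {d a} → d ∣ₚ a → a ≄ [] → len d ≤ len a
∣ₚ⇒len≤ {d} {a} d∣a@(divides q e) a≄[] = bound (≄[]⇒len≡suc q≄[])
  where
  open ≤-Reasoning
  q≄[] : q ≄ []
  q≄[] q≃[] = a≄[] (≃-trans (≃-sym e) (⊗-zeroˡ d q≃[]))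
  bound : ∃ (λ k → len q ≡ suc k) → len d ≤ len a
  bound (k , lq) = ≤-pred (begin-strict
    len d              <⟨ s≤s (m≤n+m (len d) k) ⟩
    suc k + len d      ≡⟨ cong (_+ len d) lq ⟨
    len q + len d      ≡⟨ len-⊗ q d q≄[] (∣ₚ-≄[] d∣a a≄[]) ⟨
    suc (len (q ⊗ d))  ≡⟨ cong suc (len-cong e) ⟩
    suc (len a)        ∎)

quotient-len≤ : ∀ q d {a} → (q ⊗ d) ≃ a → a ≄ [] → len q ≤ len a
quotient-len≤ q d e = ∣ₚ⇒len≤ (divides d (≃-trans (⊗-comm d q) e))

record Coprime (a b : Poly) : Set where
  constructor bezout
  field
    u v : Poly
    identity : ((u ⊗ a) ⊕ (v ⊗ b)) ≃ one

Coprime-sym : ∀ {a b} → Coprime a b → Coprime b a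
Coprime-sym {a} {b} (bezout u v e) = bezout v u (≃-trans (≡⇒≃ (⊕-comm (v ⊗ b) (u ⊗ a))) e)

Coprime-resp : ∀ {a a′ b b′} → a ≃ a′ → b ≃ b′ → Coprime a b → Coprime a′ b′
Coprime-resp e f (bezout u v eq) =
  bezout u v (≃-trans (⊕-cong (⊗-congʳ u (≃-sym e)) (⊗-congʳ v (≃-sym f))) eq)

Coprime-∣ₚˡ : ∀ {a b c} → c ∣ₚ a → Coprime a b → Coprime c b
Coprime-∣ₚˡ {a} {b} {c} (divides q e) (bezout u v eq) =
  bezout (u ⊗ q) v (≃-trans (⊕-cong (≃-trans (⊗-assoc u q c) (⊗-congʳ u e)) (≃-refl {v ⊗ b})) eq)

Coprime-∣ₚʳ : ∀ {a b c} → c ∣ₚ b → Coprime a b → Coprime a c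
Coprime-∣ₚʳ c∣b = Coprime-sym ∘ Coprime-∣ₚˡ c∣b ∘ Coprime-sym

-- Squaring the Bézout identity u a + v b = 1 gives (u² a) a + v² b² = 1.
Coprime-squareʳ : ∀ {a b} → Coprime a b → Coprime a (b ⊗ b)
Coprime-squareʳ {a} {b} (bezout u v e) = bezout ((u ⊗ u) ⊗ a) (v ⊗ v) (begin
  (((u ⊗ u) ⊗ a) ⊗ a) ⊕ ((v ⊗ v) ⊗ (b ⊗ b))
    ≈⟨ ⊕-cong (≃-trans (⊗-assoc (u ⊗ u) a a) (⊗-interchange u u a a)) (⊗-interchange v v b b) ⟩
  ((u ⊗ a) ⊗ (u ⊗ a)) ⊕ ((v ⊗ b) ⊗ (v ⊗ b))  ≈⟨ square-⊕ (u ⊗ a) (v ⊗ b) ⟨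
  ((u ⊗ a) ⊕ (v ⊗ b)) ⊗ ((u ⊗ a) ⊕ (v ⊗ b))  ≈⟨ ⊗-cong e e ⟩
  one ⊗ one                                  ≈⟨ ⊗-identityˡ one ⟩
  one                                        ∎)
  where open SetoidReasoning ≃-setoid

gauss : ∀ {a b c} → Coprime a b → a ∣ₚ (b ⊗ c) → a ∣ₚ c
gauss {a} {b} {c} (bezout u v e) a∣bc = ∣ₚ-resp ≃-refl c≃ (∣ₚ-⊕ a∣uac a∣vbc)
  where
  a∣uac : a ∣ₚ ((u ⊗ a) ⊗ c)
  a∣uac = ∣ₚ-resp ≃-refl (⊗-Props.xy∙z≈xz∙y u c a) (∣ₚ-⊗ˡ (u ⊗ c) (∣ₚ-refl a))
  a∣vbc : a ∣ₚ ((v ⊗ b) ⊗ c)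
  a∣vbc = ∣ₚ-resp ≃-refl (≃-sym (⊗-assoc v b c)) (∣ₚ-⊗ˡ v a∣bc)
  c≃ : (((u ⊗ a) ⊗ c) ⊕ ((v ⊗ b) ⊗ c)) ≃ c
  c≃ = ≃-trans (≃-sym (⊗-distribʳ (u ⊗ a) (v ⊗ b) c)) (≃-trans (⊗-congˡ c e) (⊗-identityˡ c))

Coprime⇒common-divisor-len≤1 : ∀ {a b c} → Coprime a b → c ∣ₚ a → c ∣ₚ b → len c ≤ 1
Coprime⇒common-divisor-len≤1 (bezout u v e) c∣a c∣b =
  ∣ₚ⇒len≤ (∣ₚ-resp ≃-refl e (∣ₚ-⊕ (∣ₚ-⊗ˡ u c∣a) (∣ₚ-⊗ˡ v c∣b))) λ ()

record GCD (a b : Poly) : Set where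
  constructor mkGCD
  field
    divisor : Poly
    divisor∣a : divisor ∣ₚ a
    divisor∣b : divisor ∣ₚ b
    u v : Poly
    combination : ((u ⊗ a) ⊕ (v ⊗ b)) ≃ divisor

GCD-greatest : ∀ {a b c} (G : GCD a b) → c ∣ₚ a → c ∣ₚ b → c ∣ₚ GCD.divisor G
GCD-greatest (mkGCD g _ _ u v e) c∣a c∣b = ∣ₚ-resp ≃-refl e (∣ₚ-⊕ (∣ₚ-⊗ˡ u c∣a) (∣ₚ-⊗ˡ v c∣b))

GCD-sym : ∀ {a b} → GCD a b → GCD b a
GCD-sym {a} {b} (mkGCD g g∣a g∣b u v e) = mkGCD g g∣b g∣a v u (≃-trans (≡⇒≃ (⊕-comm (v ⊗ b) (u ⊗ a))) e)

GCD-reduce : ∀ {a b} m → GCD (a ⊕ (m ⊗ b)) b → GCD a b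
GCD-reduce {a} {b} m (mkGCD g g∣a′ g∣b u v e) =
  mkGCD g (∣ₚ-resp ≃-refl (⊕-cancelʳ a (m ⊗ b)) (∣ₚ-⊕ g∣a′ (∣ₚ-⊗ˡ m g∣b))) g∣b u ((u ⊗ m) ⊕ v) (begin
    (u ⊗ a) ⊕ (((u ⊗ m) ⊕ v) ⊗ b)           ≈⟨ ⊕-cong (≃-refl {u ⊗ a}) (⊗-distribʳ (u ⊗ m) v b) ⟩
    (u ⊗ a) ⊕ (((u ⊗ m) ⊗ b) ⊕ (v ⊗ b))     ≡⟨ ⊕-assoc (u ⊗ a) _ _ ⟨
    ((u ⊗ a) ⊕ ((u ⊗ m) ⊗ b)) ⊕ (v ⊗ b)
      ≈⟨ ⊕-cong (⊕-cong (≃-refl {u ⊗ a}) (⊗-assoc u m b)) (≃-refl {v ⊗ b}) ⟩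
    ((u ⊗ a) ⊕ (u ⊗ (m ⊗ b))) ⊕ (v ⊗ b)     ≈⟨ ⊕-cong (⊗-distribˡ u a (m ⊗ b)) (≃-refl {v ⊗ b}) ⟨
    (u ⊗ (a ⊕ (m ⊗ b))) ⊕ (v ⊗ b)           ≈⟨ e ⟩
    g                                       ∎)
  where open SetoidReasoning ≃-setoid

monomial : ℕ → Poly
monomial zero = one
monomial (suc k) = false ∷ monomial k

len-monomial : ∀ k → len (monomial k) ≡ suc k
monomial-≄[] : ∀ k → monomial k ≄ []
len-monomial zero = refl
len-monomial (suc k) = trans (len-∷ false (monomial k) (monomial-≄[] k)) (cong suc (len-monomial k))
monomial-≄[] k = len-pos⇒≄[] (subst (1 ≤_) (sym (len-monomial k)) (s≤s z≤n))

len-leading-cancel : ∀ a b → a ≄ [] → b ≄ [] → len b ≤ len a →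
                     len (a ⊕ (monomial (len a ∸ len b) ⊗ b)) < len a
len-leading-cancel a b a≄[] b≄[] b≤a with j , la ← ≄[]⇒len≡suc a≄[] =
  subst (len (a ⊕ (m ⊗ b)) <_) (sym la) (s≤s (len-⊕-same a (m ⊗ b) j la len-mb))
  where
  m = monomial (len a ∸ len b)
  len-mb : len (m ⊗ b) ≡ suc j
  len-mb = suc-injective (begin
    suc (len (m ⊗ b))               ≡⟨ len-⊗ m b (monomial-≄[] _) b≄[] ⟩
    len m + len b                   ≡⟨ cong (_+ len b) (len-monomial _) ⟩
    suc (len a ∸ len b + len b)     ≡⟨ cong suc (m∸n+n≡m b≤a) ⟩
    suc (len a)                     ≡⟨ cong suc la ⟩
    suc (suc j)                     ∎)
    where open ≡-Reasoning

gcd-with-fuel : ∀ n a b → len a + len b ≤ n → GCD a b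
gcd-with-fuel n a b fuel with a ≃? [] | b ≃? []
... | yes a≃[] | _ =
  mkGCD b (∣ₚ-resp ≃-refl (≃-sym a≃[]) (divides [] ≃-refl)) (∣ₚ-refl b) [] one (⊗-identityˡ b)
... | no _ | yes b≃[] = mkGCD a (∣ₚ-refl a) (∣ₚ-resp ≃-refl (≃-sym b≃[]) (divides [] ≃-refl)) one []
                            (≃-trans (≡⇒≃ (⊕-identityʳ (one ⊗ a))) (⊗-identityˡ a))
... | no a≄[] | no b≄[] with n | ≄[]⇒len≡suc a≄[] | len b ≤? len a
...   | zero | j , la | _ with () ← subst (λ l → l + len b ≤ 0) la fuel
...   | suc n | _ | yes b≤a =
  GCD-reduce m (gcd-with-fuel n _ b
    (≤-pred (≤-trans (+-monoˡ-< (len b) (len-leading-cancel a b a≄[] b≄[] b≤a)) fuel)))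
  where m = monomial (len a ∸ len b)
...   | suc n | _ | no b≰a =
  GCD-sym (GCD-reduce m (gcd-with-fuel n _ a (≤-pred (≤-trans shorter fuel))))
  where
  m = monomial (len b ∸ len a)
  shorter : suc (len (b ⊕ (m ⊗ a)) + len a) ≤ len a + len b
  shorter = subst (suc (len (b ⊕ (m ⊗ a)) + len a) ≤_) (+-comm (len b) (len a))
              (+-monoˡ-< (len a) (len-leading-cancel b a b≄[] a≄[] (<⇒≤ (≰⇒> b≰a))))

gcd : ∀ a b → GCD a b
gcd a b = gcd-with-fuel (len a + len b) a b ≤-refl

no-common-factor⇒Coprime : ∀ {a b} → a ≄ [] →
  (∀ c → 2 ≤ len c → c ∣ₚ a → c ∣ₚ b → ⊥) → Coprime a b
no-common-factor⇒Coprime {a} {b} a≄[] no-factor with gcd a b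
... | mkGCD g g∣a g∣b u v e with 2 ≤? len g
...   | yes 2≤g = ⊥-elim (no-factor g 2≤g g∣a g∣b)
...   | no 2≰g = bezout u v (≃-trans e (≃one (∣ₚ-≄[] g∣a a≄[]) (≤-pred (≰⇒> 2≰g))))

-- The finite searches of Defs

∈-lists : ∀ L → L ∈ lists (length L)
∈-lists [] = here refl
∈-lists (false ∷ L) = ∈-++⁺ˡ (∈-map⁺ (false ∷_) (∈-lists L))
∈-lists (true ∷ L) = ∈-++⁺ʳ (map (false ∷_) (lists (length L))) (∈-map⁺ (true ∷_) (∈-lists L))

lists-length : ∀ n {L} → L ∈ lists n → length L ≡ n
lists-length zero (here refl) = refl
lists-length (suc n) {L} L∈ with ∈-++⁻ (map (false ∷_) (lists n)) L∈
... | inj₁ L∈₀ with L′ , L′∈ , refl ← ∈-map⁻ (false ∷_) L∈₀ = cong suc (lists-length n L′∈)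
... | inj₂ L∈₁ with L′ , L′∈ , refl ← ∈-map⁻ (true ∷_) L∈₁ = cong suc (lists-length n L′∈)

norm-++-zeros : ∀ p k → norm (p ++ replicate k false) ≡ norm p
norm-++-zeros [] zero = refl
norm-++-zeros [] (suc k) rewrite norm-∷ false (replicate k false) | norm-++-zeros [] k = refl
norm-++-zeros (b ∷ p) k rewrite norm-∷ b (p ++ replicate k false) | norm-∷ b p | norm-++-zeros p k = refl

-- Pad the normal form of p with zero coefficients up to length n.
representative : ∀ p n → len p ≤ n → ∃ λ L → L ∈ lists n × L ≃ p
representative p n h = L , subst (λ m → L ∈ lists m) length-L (∈-lists L) ,
                       mk≃ (trans (norm-++-zeros (norm p) (n ∸ len p)) (norm-idem p))
  where
  L = norm p ++ replicate (n ∸ len p) false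
  length-L : length L ≡ n
  length-L = trans (length-++ (norm p)) (trans (cong (len p +_) (length-replicate (n ∸ len p))) (m+[n∸m]≡n h))

length-norm≤ : ∀ L → length (norm L) ≤ length L
length-norm≤ [] = z≤n
length-norm≤ (b ∷ L) rewrite norm-∷ b L with norm L | length-norm≤ L
... | [] | _ with b
...   | true = s≤s z≤n
...   | false = z≤n
length-norm≤ (b ∷ L) | x ∷ q | h = s≤s h

search-sound : ∀ (p : Poly → Bool) n → T (any p (lists n)) → ∃ λ L → T (p L)
search-sound p n = satisfied ∘ any⁻ p (lists n)

search-complete : ∀ (p : Poly → Bool) n q → len q ≤ n → (∀ {L} → L ≃ q → T (p L)) →
                  T (any p (lists n))
search-complete p n q h pq with L , L∈ , L≃q ← representative q n h = any⁺ p (lose L∈ (pq L≃q))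

≈ᵇ-sound : ∀ p q → T (p ≈ᵇ q) → p ≃ q
≈ᵇ-sound p q t with ≡-dec _≟B_ (norm p) (norm q)
... | yes e = mk≃ e

≈ᵇ-complete : ∀ {p q} → p ≃ q → T (p ≈ᵇ q)
≈ᵇ-complete {p} {q} (mk≃ e) with ≡-dec _≟B_ (norm p) (norm q)
... | yes _ = tt
... | no ne = ne e

nonzeroᵇ-sound : ∀ p → T (nonzeroᵇ p) → p ≄ []
nonzeroᵇ-sound p t p≃[] with p ≈ᵇ [] | ≈ᵇ-complete p≃[]
... | true | _ = t

nonzeroᵇ-complete : ∀ p → p ≄ [] → T (nonzeroᵇ p)
nonzeroᵇ-complete p p≄[] with p ≈ᵇ [] in eq
... | false = tt
... | true = p≄[] (≈ᵇ-sound p [] (Equivalence.from T-≡ eq))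

nonconstᵇ-sound : ∀ c → T (nonconstᵇ c) → 2 ≤ len c
nonconstᵇ-sound c = ≤ᵇ⇒≤ 2 (len c)

nonconstᵇ-complete : ∀ c → 2 ≤ len c → T (nonconstᵇ c)
nonconstᵇ-complete c = ≤⇒≤ᵇ

divᵇ-sound : ∀ d a → T (divᵇ d a) → d ∣ₚ a
divᵇ-sound d a t with q , found ← search-sound (λ q → (q ⊗ d) ≈ᵇ a) (len a) t =
  divides q (≈ᵇ-sound (q ⊗ d) a found)

divᵇ-complete : ∀ {d a} → d ∣ₚ a → T (divᵇ d a)
divᵇ-complete {d} {a} (divides q e) with a ≃? []
... | yes a≃[] = search-complete (λ q → (q ⊗ d) ≈ᵇ a) (len a) [] z≤n
                   (λ L≃[] → ≈ᵇ-complete (≃-trans (⊗-zeroˡ d L≃[]) (≃-sym a≃[])))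
... | no a≄[] = search-complete (λ q → (q ⊗ d) ≈ᵇ a) (len a) q (quotient-len≤ q d e a≄[])
                  (λ L≃q → ≈ᵇ-complete (≃-trans (⊗-congˡ d L≃q) e))

IsCommonFactorᵇ : Poly → Poly → Poly → Bool
IsCommonFactorᵇ e f c = nonconstᵇ c ∧ (divᵇ c e ∧ divᵇ c f)

IsCommonFactorᵇ-sound : ∀ e f c → T (IsCommonFactorᵇ e f c) → 2 ≤ len c × c ∣ₚ e × c ∣ₚ f
IsCommonFactorᵇ-sound e f c t with nonconst , divs ← Equivalence.to (T-∧ {nonconstᵇ c}) t
  with c∣e , c∣f ← Equivalence.to (T-∧ {divᵇ c e}) divs =
  nonconstᵇ-sound c nonconst , divᵇ-sound c e c∣e , divᵇ-sound c f c∣f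

IsCommonFactorᵇ-complete : ∀ {e f c} → 2 ≤ len c → c ∣ₚ e → c ∣ₚ f → T (IsCommonFactorᵇ e f c)
IsCommonFactorᵇ-complete {e} {f} {c} 2≤c c∣e c∣f =
  Equivalence.from (T-∧ {nonconstᵇ c}) (nonconstᵇ-complete c 2≤c ,
    Equivalence.from (T-∧ {divᵇ c e}) (divᵇ-complete c∣e , divᵇ-complete c∣f))

coprimeᵇ-sound : ∀ {e f} → e ≄ [] → T (coprimeᵇ e f) → Coprime e f
coprimeᵇ-sound {e} {f} e≄[] t = no-common-factor⇒Coprime e≄[] λ c 2≤c c∣e c∣f →
  subst T (Equivalence.to T-not-≡ t)
    (search-complete (IsCommonFactorᵇ e f) (len e) c (∣ₚ⇒len≤ c∣e e≄[]) λ L≃c →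
      IsCommonFactorᵇ-complete (subst (2 ≤_) (sym (len-cong L≃c)) 2≤c)
                               (∣ₚ-resp (≃-sym L≃c) ≃-refl c∣e) (∣ₚ-resp (≃-sym L≃c) ≃-refl c∣f))

coprimeᵇ-complete : ∀ {e f} → Coprime e f → T (coprimeᵇ e f)
coprimeᵇ-complete {e} {f} cop with any (IsCommonFactorᵇ e f) (lists (len e)) in eq
... | false = tt
... | true with c , t ← search-sound (IsCommonFactorᵇ e f) (len e) (Equivalence.from T-≡ eq)
  with 2≤c , c∣e , c∣f ← IsCommonFactorᵇ-sound e f c t =
  contradiction (≤-trans 2≤c (Coprime⇒common-divisor-len≤1 cop c∣e c∣f)) λ { (s≤s ()) }

IsUnitaryDivisor : Poly → Poly → Set
IsUnitaryDivisor d a = ∃ λ q → ((q ⊗ d) ≃ a) × Coprime d q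

unitaryᵇ-sound : ∀ {d a} → d ≄ [] → T (unitaryᵇ d a) → IsUnitaryDivisor d a
unitaryᵇ-sound {d} {a} d≄[] t
  with q , found ← search-sound (λ q → ((q ⊗ d) ≈ᵇ a) ∧ coprimeᵇ d q) (len a) t
  with q⊗d≈a , coprime ← Equivalence.to (T-∧ {(q ⊗ d) ≈ᵇ a}) found =
  q , ≈ᵇ-sound (q ⊗ d) a q⊗d≈a , coprimeᵇ-sound d≄[] coprime

unitaryᵇ-complete : ∀ {d a} → a ≄ [] → IsUnitaryDivisor d a → T (unitaryᵇ d a)
unitaryᵇ-complete {d} {a} a≄[] (q , e , cop) =
  search-complete (λ q → ((q ⊗ d) ≈ᵇ a) ∧ coprimeᵇ d q) (len a) q (quotient-len≤ q d e a≄[])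
    λ {L} L≃q → Equivalence.from (T-∧ {(L ⊗ d) ≈ᵇ a})
                  (≈ᵇ-complete (≃-trans (⊗-congˡ d L≃q) e) ,
                   coprimeᵇ-complete (Coprime-resp ≃-refl (≃-sym L≃q) cop))

normals : ℕ → List Poly
normals n = map norm (lists n)

normals-suc : ∀ n → normals (suc n) ≡ map (consₙ false) (normals n) ++ map (consₙ true) (normals n)
normals-suc n = begin
  map norm (map (false ∷_) (lists n) ++ map (true ∷_) (lists n))
    ≡⟨ map-++ norm (map (false ∷_) (lists n)) _ ⟩
  map norm (map (false ∷_) (lists n)) ++ map norm (map (true ∷_) (lists n))
    ≡⟨ cong₂ _++_ (cons-step false) (cons-step true) ⟩
  map (consₙ false) (normals n) ++ map (consₙ true) (normals n) ∎
  where
  open ≡-Reasoning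
  cons-step : ∀ b → map norm (map (b ∷_) (lists n)) ≡ map (consₙ b) (normals n)
  cons-step b = trans (sym (map-∘ (lists n))) (trans (map-cong (norm-∷ b) (lists n)) (map-∘ (lists n)))

consₙ-injective : ∀ b {p q} → consₙ b p ≡ consₙ b q → p ≡ q
consₙ-injective b {[]} {[]} _ = refl
consₙ-injective true {[]} {x ∷ q} ()
consₙ-injective false {[]} {x ∷ q} ()
consₙ-injective true {x ∷ p} {[]} ()
consₙ-injective false {x ∷ p} {[]} ()
consₙ-injective b {x ∷ p} {y ∷ q} refl = refl

consₙ-false≢consₙ-true : ∀ p q → consₙ false p ≢ consₙ true q
consₙ-false≢consₙ-true [] [] ()
consₙ-false≢consₙ-true [] (y ∷ q) ()
consₙ-false≢consₙ-true (x ∷ p) [] ()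
consₙ-false≢consₙ-true (x ∷ p) (y ∷ q) ()

normals-unique : ∀ n → Unique (normals n)
normals-unique zero = All.[] AllPairs.∷ AllPairs.[]
normals-unique (suc n) rewrite normals-suc n =
  Unique.++⁺ (Unique.map⁺ (consₙ-injective false) (normals-unique n))
             (Unique.map⁺ (consₙ-injective true) (normals-unique n))
             disjoint
  where
  disjoint : ∀ {x} → x ∈ map (consₙ false) (normals n) × x ∈ map (consₙ true) (normals n) → ⊥
  disjoint (x∈₀ , x∈₁) with p , _ , refl ← ∈-map⁻ (consₙ false) x∈₀ | q , _ , x≡ ← ∈-map⁻ (consₙ true) x∈₁ =
    consₙ-false≢consₙ-true p q x≡

∈-normals⁺ : ∀ n {p} → norm p ≡ p → len p ≤ n → p ∈ normals n
∈-normals⁺ n {p} np h with L , L∈ , L≃p ← representative p n h =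
  subst (_∈ normals n) (trans (norm-≡ L≃p) np) (∈-map⁺ norm L∈)

∈-normals⁻ : ∀ n {p} → p ∈ normals n → norm p ≡ p
∈-normals⁻ n p∈ with L , _ , refl ← ∈-map⁻ norm p∈ = norm-idem L

∈-normals⇒len≤ : ∀ n {p} → p ∈ normals n → len p ≤ n
∈-normals⇒len≤ n p∈ with L , L∈ , refl ← ∈-map⁻ norm p∈ =
  subst₂ _≤_ (sym (cong length (norm-idem L))) (lists-length n L∈) (length-norm≤ L)

IsDivisorᵇ : Poly → Poly → Bool
IsDivisorᵇ a d = nonzeroᵇ d ∧ divᵇ d a

∈-divisors⁻ : ∀ a {d} → d ∈ divisors a → norm d ≡ d × d ≄ [] × d ∣ₚ a
∈-divisors⁻ a {d} d∈ with d∈ₙ , t ← ∈-filter⁻ (T? ∘ IsDivisorᵇ a) {xs = normals (len a)} d∈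
  with nonzero , divisor ← Equivalence.to (T-∧ {nonzeroᵇ d}) t =
  ∈-normals⁻ (len a) d∈ₙ , nonzeroᵇ-sound d nonzero , divᵇ-sound d a divisor

∈-divisors⁺ : ∀ {a d} → a ≄ [] → norm d ≡ d → d ≄ [] → d ∣ₚ a → d ∈ divisors a
∈-divisors⁺ {a} {d} a≄[] nd d≄[] d∣a =
  ∈-filter⁺ (T? ∘ IsDivisorᵇ a) (∈-normals⁺ (len a) nd (∣ₚ⇒len≤ d∣a a≄[]))
            (Equivalence.from (T-∧ {nonzeroᵇ d}) (nonzeroᵇ-complete d d≄[] , divᵇ-complete d∣a))

∈-divisors⇒≄[] : ∀ a {d} → d ∈ divisors a → a ≄ []
∈-divisors⇒≄[] a {d} d∈ a≃[] with d∈ₙ , _ ← ∈-filter⁻ (T? ∘ IsDivisorᵇ a) {xs = normals (len a)} d∈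
  with k , len-d ← ≄[]⇒len≡suc (proj₁ (proj₂ (∈-divisors⁻ a d∈)))
  with () ← ≤-trans (≤-reflexive (sym len-d)) (subst (len d ≤_) (len-cong a≃[]) (∈-normals⇒len≤ (len a) d∈ₙ))

divisors-unique : ∀ a → Unique (divisors a)
divisors-unique a = Unique.filter⁺ (T? ∘ IsDivisorᵇ a) (normals-unique (len a))

_≟ₚ_ : DecidableEquality Poly
_≟ₚ_ = ≡-dec _≟B_

-- Exact division by search; the value [] when d ∤ a is junk.
infixl 7 _÷_
_÷_ : Poly → Poly → Poly
a ÷ d with any? (λ q → (q ⊗ d) ≃? a) (lists (len a))
... | yes found = norm (proj₁ (satisfied found))
... | no _ = []

÷-normal : ∀ a d → norm (a ÷ d) ≡ a ÷ d
÷-normal a d with any? (λ q → (q ⊗ d) ≃? a) (lists (len a))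
... | yes found = norm-idem (proj₁ (satisfied found))
... | no _ = refl

÷-correct : ∀ {a d} → a ≄ [] → d ∣ₚ a → ((a ÷ d) ⊗ d) ≃ a
÷-correct {a} {d} a≄[] (divides q e) with any? (λ q → (q ⊗ d) ≃? a) (lists (len a))
... | yes found = ≃-trans (⊗-congˡ d (norm-≃ (proj₁ (satisfied found)))) (proj₂ (satisfied found))
... | no none with L , L∈ , L≃q ← representative q (len a) (quotient-len≤ q d e a≄[]) =
  contradiction (lose L∈ (≃-trans (⊗-congˡ d L≃q) e)) none

-- Lists without repetitions and their sums

↭-unique : ∀ {A : Set} {xs ys : List A} → Unique xs → Unique ys →
           (∀ {x} → x ∈ xs → x ∈ ys) → (∀ {x} → x ∈ ys → x ∈ xs) → xs ↭ ys
↭-unique xs! ys! to from = ∼bag⇒↭ (unique∧set⇒bag xs! ys! (mk⇔ to from))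

Unique-map⁺ : ∀ {A B : Set} {f : A → B} {xs} → (∀ {x y} → x ∈ xs → y ∈ xs → f x ≡ f y → x ≡ y) →
              Unique xs → Unique (map f xs)
Unique-map⁺ {xs = []} _ _ = AllPairs.[]
Unique-map⁺ {f = f} {xs = x ∷ xs} injective (x∉xs AllPairs.∷ xs!) =
  All-map⁺ (All.tabulate λ y∈ fx≡fy → All.lookup x∉xs y∈ (injective (here refl) (there y∈) fx≡fy))
  AllPairs.∷ Unique-map⁺ (λ x∈ y∈ → injective (there x∈) (there y∈)) xs!

module _ {A : Set} (_≟_ : DecidableEquality A) where

  _without_ : List A → A → List A
  xs without x = filter (λ y → ¬? (y ≟ x)) xs

  ∈-without⁻ : ∀ {xs x y} → y ∈ xs without x → y ∈ xs × y ≢ x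
  ∈-without⁻ = ∈-filter⁻ (λ y → ¬? (y ≟ _))

  ∈-without⁺ : ∀ {xs x y} → y ∈ xs → y ≢ x → y ∈ xs without x
  ∈-without⁺ = ∈-filter⁺ (λ y → ¬? (y ≟ _))

  length-without : ∀ {xs x} → Unique xs → x ∈ xs → length xs ≡ suc (length (xs without x))
  length-without {xs} {x} xs! x∈xs = ↭-length (↭-unique xs! x∷rest! to from)
    where
    x∷rest! : Unique (x ∷ xs without x)
    x∷rest! = All.map (λ y≢x → y≢x ∘ sym) (all-filter (λ y → ¬? (y ≟ x)) xs)
              AllPairs.∷ Unique.filter⁺ (λ y → ¬? (y ≟ x)) xs!
    to : ∀ {y} → y ∈ xs → y ∈ x ∷ xs without x
    to {y} y∈xs with y ≟ x
    ... | yes refl = here refl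
    ... | no y≢x = there (∈-without⁺ y∈xs y≢x)
    from : ∀ {y} → y ∈ x ∷ xs without x → y ∈ xs
    from (here refl) = x∈xs
    from (there y∈) = proj₁ (∈-without⁻ y∈)

  module _ (ι : A → A) where

    IsInvolutionOn : List A → Set
    IsInvolutionOn xs = (∀ {x} → x ∈ xs → ι x ∈ xs) × (∀ {x} → x ∈ xs → ι (ι x) ≡ x)

    without-fixed : ∀ {xs t} → IsInvolutionOn xs → ι t ≡ t → IsInvolutionOn (xs without t)
    without-fixed {xs} {t} (closed , involutive) ιt≡t = closed′ , involutive ∘ proj₁ ∘ ∈-without⁻
      where
      closed′ : ∀ {y} → y ∈ xs without t → ι y ∈ xs without t
      closed′ y∈ with y∈xs , y≢t ← ∈-without⁻ y∈ =
        ∈-without⁺ (closed y∈xs) λ ιy≡t → y≢t (trans (sym (involutive y∈xs)) (trans (cong ι ιy≡t) ιt≡t))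

    without-orbit : ∀ {xs x} → IsInvolutionOn xs → x ∈ xs → IsInvolutionOn ((xs without x) without ι x)
    without-orbit {xs} {x} (closed , involutive) x∈xs =
      closed′ , involutive ∘ proj₁ ∘ ∈-without⁻ ∘ proj₁ ∘ ∈-without⁻
      where
      closed′ : ∀ {y} → y ∈ (xs without x) without ι x → ι y ∈ (xs without x) without ι x
      closed′ y∈ with y∈′ , y≢ιx ← ∈-without⁻ y∈ with y∈xs , y≢x ← ∈-without⁻ y∈′ =
        ∈-without⁺ (∈-without⁺ (closed y∈xs) λ ιy≡x → y≢ιx (trans (sym (involutive y∈xs)) (cong ι ιy≡x)))
                   λ ιy≡ιx → y≢x (trans (sym (involutive y∈xs)) (trans (cong ι ιy≡ιx) (involutive x∈xs)))

    involution-even : ∀ n {xs} → length xs ≤ n → Unique xs → IsInvolutionOn xs →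
                      (∀ {x} → x ∈ xs → ι x ≢ x) → length xs % 2 ≡ 0
    involution-even _ {[]} _ _ _ _ = refl
    involution-even zero {_ ∷ _} ()
    involution-even (suc n) {xs@(x ∷ _)} length≤ xs! inv no-fixpoint =
      trans (cong (_% 2) length-xs)
            (involution-even n (≤-pred (≤-trans (n≤1+n _) (subst (_≤ suc n) length-xs length≤)))
                             rest! (without-orbit inv (here refl))
                             (no-fixpoint ∘ proj₁ ∘ ∈-without⁻ ∘ proj₁ ∘ ∈-without⁻))
      where
      rest = (xs without x) without ι x
      xs-x! : Unique (xs without x)
      xs-x! = Unique.filter⁺ (λ y → ¬? (y ≟ x)) xs!
      rest! : Unique rest
      rest! = Unique.filter⁺ (λ y → ¬? (y ≟ ι x)) xs-x!
      length-xs : length xs ≡ suc (suc (length rest))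
      length-xs = trans (length-without xs! (here refl))
        (cong suc (length-without xs-x! (∈-without⁺ (proj₁ inv (here refl)) (no-fixpoint (here refl)))))

    involution-odd : ∀ {xs t} → Unique xs → IsInvolutionOn xs → t ∈ xs → ι t ≡ t →
                     (∀ {x} → x ∈ xs → ι x ≡ x → x ≡ t) → length xs % 2 ≡ 1
    involution-odd {xs} {t} xs! inv t∈xs ιt≡t fixed⇒t = begin
      length xs % 2                          ≡⟨ cong (_% 2) (length-without xs! t∈xs) ⟩
      (1 + length (xs without t)) % 2        ≡⟨ %-distribˡ-+ 1 (length (xs without t)) 2 ⟩
      (1 + length (xs without t) % 2) % 2    ≡⟨ cong (λ r → (1 + r) % 2) rest-even ⟩
      1                                      ∎
      where
      open ≡-Reasoning
      rest-even : length (xs without t) % 2 ≡ 0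
      rest-even = involution-even _ ≤-refl (Unique.filter⁺ (λ y → ¬? (y ≟ t)) xs!) (without-fixed inv ιt≡t)
                                  no-fixpoint
        where
        no-fixpoint : ∀ {y} → y ∈ xs without t → ι y ≢ y
        no-fixpoint y∈ ιy≡y with y∈xs , y≢t ← ∈-without⁻ y∈ = y≢t (fixed⇒t y∈xs ιy≡y)

sumP-↭ : ∀ {xs ys} → xs ↭ ys → sumP xs ≡ sumP ys
sumP-↭ = PermutationProperties.foldr-commMonoid (setoid Poly)
           (CommutativeMonoid.isCommutativeMonoid ⊕-commutativeMonoid) ∘ ↭⇒↭ₛ

sumP-cong : ∀ {B : Set} (f g : B → Poly) xs → (∀ {x} → x ∈ xs → f x ≃ g x) →
            sumP (map f xs) ≃ sumP (map g xs)
sumP-cong f g [] h = ≃-refl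
sumP-cong f g (x ∷ xs) h = ⊕-cong (h (here refl)) (sumP-cong f g xs (h ∘ there))

sumP-zero : ∀ {B : Set} (xs : List B) → sumP (map (λ _ → []) xs) ≡ []
sumP-zero [] = refl
sumP-zero (x ∷ xs) = sumP-zero xs

sumP-⊕ : ∀ {B : Set} (f g : B → Poly) xs →
         sumP (map f xs) ⊕ sumP (map g xs) ≡ sumP (map (λ x → f x ⊕ g x) xs)
sumP-⊕ f g [] = refl
sumP-⊕ f g (x ∷ xs) = trans (⊕-interchange (f x) _ (g x) _) (cong ((f x ⊕ g x) ⊕_) (sumP-⊕ f g xs))

sumP-swap : ∀ {B C : Set} (f : B → C → Poly) xs ys →
  sumP (map (λ x → sumP (map (f x) ys)) xs) ≡ sumP (map (λ y → sumP (map (λ x → f x y) xs)) ys)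
sumP-swap f [] ys = sym (sumP-zero ys)
sumP-swap f (x ∷ xs) ys = trans (cong (sumP (map (f x) ys) ⊕_) (sumP-swap f xs ys)) (sumP-⊕ (f x) _ ys)

sumP-filterᵇ : ∀ {B : Set} (f : B → Poly) (p : B → Bool) xs →
  sumP (map f (filterᵇ p xs)) ≡ sumP (map (λ x → if p x then f x else []) xs)
sumP-filterᵇ f p [] = refl
sumP-filterᵇ f p (x ∷ xs) with p x
... | true = cong (f x ⊕_) (sumP-filterᵇ f p xs)
... | false = sumP-filterᵇ f p xs

sumP-const-odd : ∀ {B : Set} e (xs : List B) → length xs % 2 ≡ 1 → sumP (map (λ _ → e) xs) ≃ e
sumP-const-odd e (_ ∷ []) _ = ≡⇒≃ (⊕-identityʳ e)
sumP-const-odd e (_ ∷ _ ∷ xs) odd = begin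
  e ⊕ (e ⊕ sumP (map (λ _ → e) xs))  ≡⟨ ⊕-assoc e e _ ⟨
  (e ⊕ e) ⊕ sumP (map (λ _ → e) xs)  ≈⟨ ⊕-cong (⊕-self e) ≃-refl ⟩
  sumP (map (λ _ → e) xs)            ≈⟨ sumP-const-odd e xs odd ⟩
  e                                  ∎
  where open SetoidReasoning ≃-setoid

-- Parity counts

divisors-square-odd : ∀ t → t ≄ [] → length (divisors (t ⊗ t)) % 2 ≡ 1
divisors-square-odd t t≄[] = involution-odd _≟ₚ_ ι (divisors-unique (t ⊗ t)) (closed , involutive)
                               t′∈ ιt′≡t′ fixed⇒t′
  where
  t² = t ⊗ t
  t²≄[] : t² ≄ []
  t²≄[] = ⊗-≄[] t≄[] t≄[]
  ι : Poly → Poly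
  ι f = t² ÷ f
  ι-correct : ∀ {f} → f ∈ divisors t² → (ι f ⊗ f) ≃ t²
  ι-correct f∈ = ÷-correct t²≄[] (proj₂ (proj₂ (∈-divisors⁻ t² f∈)))
  ι-≄[] : ∀ {f} → f ∈ divisors t² → ι f ≄ []
  ι-≄[] {f} f∈ ιf≃[] = t²≄[] (≃-trans (≃-sym (ι-correct f∈)) (⊗-zeroˡ f ιf≃[]))
  closed : ∀ {f} → f ∈ divisors t² → ι f ∈ divisors t²
  closed {f} f∈ =
    ∈-divisors⁺ t²≄[] (÷-normal t² f) (ι-≄[] f∈) (divides f (≃-trans (⊗-comm f (ι f)) (ι-correct f∈)))
  involutive : ∀ {f} → f ∈ divisors t² → ι (ι f) ≡ f
  involutive {f} f∈ = ≃-normal⇒≡ (÷-normal t² (ι f)) (proj₁ (∈-divisors⁻ t² f∈))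
    (⊗-cancelʳ (ι-≄[] f∈) (≃-trans (ι-correct (closed f∈)) (≃-trans (≃-sym (ι-correct f∈)) (⊗-comm (ι f) f))))
  t′ = norm t
  t′≄[] : t′ ≄ []
  t′≄[] = t≄[] ∘ ≃-trans (≃-sym (norm-≃ t))
  t′∈ : t′ ∈ divisors t²
  t′∈ = ∈-divisors⁺ t²≄[] (norm-idem t) t′≄[] (divides t (⊗-congʳ t (norm-≃ t)))
  ιt′≡t′ : ι t′ ≡ t′
  ιt′≡t′ = ≃-normal⇒≡ (÷-normal t² t′) (norm-idem t)
    (⊗-cancelʳ t′≄[] (≃-trans (ι-correct t′∈) (≃-sym (⊗-cong (norm-≃ t) (norm-≃ t)))))
  fixed⇒t′ : ∀ {f} → f ∈ divisors t² → ι f ≡ f → f ≡ t′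
  fixed⇒t′ {f} f∈ ιf≡f = ≃-normal⇒≡ (proj₁ (∈-divisors⁻ t² f∈)) (norm-idem t)
    (≃-trans (square-injective (subst (λ g → (g ⊗ f) ≃ t²) ιf≡f (ι-correct f∈))) (≃-sym (norm-≃ t)))

-- If s = t g with g = gcd(e, s), a common factor c of e and t divides g as well, so c² ∣ s.
squarefree⇒coprime-cofactor : ∀ {e s t} → SquareFree s → e ≄ [] → (G : GCD e s) →
                              (t ⊗ GCD.divisor G) ≃ s → Coprime e t
squarefree⇒coprime-cofactor {e} {s} {t} (_ , no-square) e≄[] G t⊗g≃s =
  no-common-factor⇒Coprime e≄[] λ c 2≤c c∣e c∣t →
    let c∣s = ∣ₚ-trans c∣t (divides (GCD.divisor G) (≃-trans (⊗-comm _ t) t⊗g≃s))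
        c²∣s = ∣ₚ-resp ≃-refl t⊗g≃s (⊗-pres-∣ₚ c∣t (GCD-greatest G c∣e c∣s))
    in no-square c 2≤c (quotient c²∣s , norm-≡ (equation c²∣s))

unitary-multiples-in : Poly → List Poly → List Poly
unitary-multiples-in e = filterᵇ (unitaryᵇ e)

module _ {a t g e : Poly} (a≃t²g² : a ≃ ((t ⊗ t) ⊗ (g ⊗ g))) (e∈ : e ∈ divisors a)
         (g∣e : g ∣ₚ e) (e⊥t : Coprime e t) where

  private
    a≄[] : a ≄ []
    a≄[] = ∈-divisors⇒≄[] a e∈

    e≄[] : e ≄ []
    e≄[] = proj₁ (proj₂ (∈-divisors⁻ a e∈))

    e⊥t² : Coprime e (t ⊗ t)
    e⊥t² = Coprime-squareʳ e⊥t

    e∣g² : e ∣ₚ (g ⊗ g)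
    e∣g² = gauss e⊥t² (∣ₚ-resp ≃-refl a≃t²g² (proj₂ (proj₂ (∈-divisors⁻ a e∈))))

    t²≄[] : (t ⊗ t) ≄ []
    t²≄[] t²≃[] = a≄[] (≃-trans a≃t²g² (⊗-zeroˡ (g ⊗ g) t²≃[]))

  multiple : Poly → Poly
  multiple f = norm (f ⊗ e)

  multiple-∈ : ∀ {f} → f ∈ divisors (t ⊗ t) → multiple f ∈ unitary-multiples-in e (divisors a)
  multiple-∈ {f} f∈ with _ , f≄[] , f∣t² ← ∈-divisors⁻ (t ⊗ t) f∈ =
    ∈-filter⁺ (T? ∘ unitaryᵇ e) (∈-divisors⁺ a≄[] (norm-idem (f ⊗ e)) fe≄[] fe∣a)
              (unitaryᵇ-complete fe≄[] (f , ≃-sym (norm-≃ (f ⊗ e)) , Coprime-∣ₚʳ f∣t² e⊥t²))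
    where
    fe≄[] : multiple f ≄ []
    fe≄[] = ⊗-≄[] f≄[] e≄[] ∘ ≃-trans (≃-sym (norm-≃ (f ⊗ e)))
    fe∣a : multiple f ∣ₚ a
    fe∣a = ∣ₚ-resp (≃-sym (norm-≃ (f ⊗ e))) (≃-sym a≃t²g²) (⊗-pres-∣ₚ f∣t² e∣g²)

  -- The cofactor q of a unitary divisor e of d is coprime to g ∣ e, hence to g², so q ∣ t² by Gauss.
  multiple-surjective : ∀ {d} → d ∈ unitary-multiples-in e (divisors a) →
                        ∃ λ f → f ∈ divisors (t ⊗ t) × multiple f ≡ d
  multiple-surjective {d} d∈ with d∈a , unitary ← ∈-filter⁻ (T? ∘ unitaryᵇ e) {xs = divisors a} d∈
    with nd , d≄[] , d∣a ← ∈-divisors⁻ a d∈a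
    with q , q⊗e≃d , e⊥q ← unitaryᵇ-sound e≄[] unitary =
    norm q ,
    ∈-divisors⁺ t²≄[] (norm-idem q) (q≄[] ∘ ≃-trans (≃-sym (norm-≃ q))) (∣ₚ-resp (≃-sym (norm-≃ q)) ≃-refl q∣t²) ,
    ≃-normal⇒≡ (norm-idem (norm q ⊗ e)) nd
      (≃-trans (norm-≃ (norm q ⊗ e)) (≃-trans (⊗-congˡ e (norm-≃ q)) q⊗e≃d))
    where
    q≄[] : q ≄ []
    q≄[] q≃[] = d≄[] (≃-trans (≃-sym q⊗e≃d) (⊗-zeroˡ e q≃[]))
    q∣a : q ∣ₚ a
    q∣a = ∣ₚ-trans (divides e (≃-trans (⊗-comm e q) q⊗e≃d)) d∣a
    q∣t² : q ∣ₚ (t ⊗ t)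
    q∣t² = gauss (Coprime-squareʳ (Coprime-∣ₚʳ g∣e (Coprime-sym e⊥q)))
                 (∣ₚ-resp ≃-refl (≃-trans a≃t²g² (⊗-comm (t ⊗ t) (g ⊗ g))) q∣a)

  multiple-injective : ∀ {f f′} → f ∈ divisors (t ⊗ t) → f′ ∈ divisors (t ⊗ t) →
                       multiple f ≡ multiple f′ → f ≡ f′
  multiple-injective {f} {f′} f∈ f′∈ eq =
    ≃-normal⇒≡ (proj₁ (∈-divisors⁻ (t ⊗ t) f∈)) (proj₁ (∈-divisors⁻ (t ⊗ t) f′∈))
      (⊗-cancelʳ e≄[] (≃-trans (≃-sym (norm-≃ (f ⊗ e))) (≃-trans (≡⇒≃ eq) (norm-≃ (f′ ⊗ e)))))

  length-unitary-multiples : length (unitary-multiples-in e (divisors a)) ≡ length (divisors (t ⊗ t))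
  length-unitary-multiples = begin
    length (unitary-multiples-in e (divisors a))    ≡⟨ ↭-length images↭ ⟨
    length (map multiple (divisors (t ⊗ t)))      ≡⟨ length-map multiple (divisors (t ⊗ t)) ⟩
    length (divisors (t ⊗ t))                     ∎
    where
    open ≡-Reasoning
    images↭ : map multiple (divisors (t ⊗ t)) ↭ unitary-multiples-in e (divisors a)
    images↭ = ↭-unique (Unique-map⁺ multiple-injective (divisors-unique (t ⊗ t)))
                       (Unique.filter⁺ (T? ∘ unitaryᵇ e) (divisors-unique a))
                       (λ d∈ → case ∈-map⁻ multiple d∈ of λ { (f , f∈ , refl) → multiple-∈ f∈ })
                       (λ d∈ → case multiple-surjective d∈ of λ { (f , f∈ , refl) → ∈-map⁺ multiple f∈ })

unitary-multiples-odd : ∀ {a s e} → SquareFree s → a ≃ (s ⊗ s) → e ∈ divisors a →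
                        length (unitary-multiples-in e (divisors a)) % 2 ≡ 1
unitary-multiples-odd {a} {s} {e} s-squarefree a≃s² e∈ =
  trans (cong (_% 2) (length-unitary-multiples a≃t²g² e∈ (GCD.divisor∣a G) e⊥t))
        (divisors-square-odd t t≄[])
  where
  s≄[] : s ≄ []
  s≄[] = proj₁ s-squarefree ∘ norm-≡
  G = gcd e s
  g = GCD.divisor G
  t = quotient (GCD.divisor∣b G)
  t⊗g≃s : (t ⊗ g) ≃ s
  t⊗g≃s = equation (GCD.divisor∣b G)
  t≄[] : t ≄ []
  t≄[] t≃[] = s≄[] (≃-trans (≃-sym t⊗g≃s) (⊗-zeroˡ g t≃[]))
  a≃t²g² : a ≃ ((t ⊗ t) ⊗ (g ⊗ g))
  a≃t²g² = ≃-trans a≃s² (≃-trans (⊗-cong (≃-sym t⊗g≃s) (≃-sym t⊗g≃s)) (⊗-interchange t g t g))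
  e⊥t : Coprime e t
  e⊥t = squarefree⇒coprime-cofactor s-squarefree (proj₁ (proj₂ (∈-divisors⁻ a e∈))) G t⊗g≃s

-- The double sum

unitary-divisors-in : Poly → List Poly → List Poly
unitary-divisors-in d = filterᵇ (λ e → unitaryᵇ e d)

∈-unitary-divisors-in⁻ : ∀ d {e} xs → e ∈ unitary-divisors-in d xs → e ∈ xs × T (unitaryᵇ e d)
∈-unitary-divisors-in⁻ d xs = ∈-filter⁻ (T? ∘ (λ e → unitaryᵇ e d)) {xs = xs}

∈-unitary-divisors-in⁺ : ∀ d {e xs} → e ∈ xs → T (unitaryᵇ e d) → e ∈ unitary-divisors-in d xs
∈-unitary-divisors-in⁺ d = ∈-filter⁺ (T? ∘ (λ e → unitaryᵇ e d))

unitary-divisors-in-unique : ∀ d {xs} → Unique xs → Unique (unitary-divisors-in d xs)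
unitary-divisors-in-unique d = Unique.filter⁺ (T? ∘ (λ e → unitaryᵇ e d))

unitary-divisors-in-divisors↭ : ∀ {a d} → d ∈ divisors a →
                                unitary-divisors-in d (divisors d) ↭ unitary-divisors-in d (divisors a)
unitary-divisors-in-divisors↭ {a} {d} d∈ with _ , d≄[] , d∣a ← ∈-divisors⁻ a d∈ =
  ↭-unique (unitary-divisors-in-unique d (divisors-unique d))
           (unitary-divisors-in-unique d (divisors-unique a)) to from
  where
  to : ∀ {e} → e ∈ unitary-divisors-in d (divisors d) → e ∈ unitary-divisors-in d (divisors a)
  to e∈ with e∈d , unitary ← ∈-unitary-divisors-in⁻ d (divisors d) e∈
    with ne , e≄[] , e∣d ← ∈-divisors⁻ d e∈d =
    ∈-unitary-divisors-in⁺ d (∈-divisors⁺ (∈-divisors⇒≄[] a d∈) ne e≄[] (∣ₚ-trans e∣d d∣a)) unitary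
  from : ∀ {e} → e ∈ unitary-divisors-in d (divisors a) → e ∈ unitary-divisors-in d (divisors d)
  from e∈ with e∈a , unitary ← ∈-unitary-divisors-in⁻ d (divisors a) e∈
    with ne , e≄[] , _ ← ∈-divisors⁻ a e∈a
    with q , q⊗e≃d , _ ← unitaryᵇ-sound e≄[] unitary =
    ∈-unitary-divisors-in⁺ d (∈-divisors⁺ d≄[] ne e≄[] (divides q q⊗e≃d)) unitary

σ*-over-multiple : ∀ {a d} → d ∈ divisors a →
                   σ* d ≡ sumP (map (λ e → if unitaryᵇ e d then e else []) (divisors a))
σ*-over-multiple {a} {d} d∈ = begin
  sumP (unitary-divisors-in d (divisors d))
    ≡⟨ sumP-↭ (unitary-divisors-in-divisors↭ {a} d∈) ⟩
  sumP (unitary-divisors-in d (divisors a))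
    ≡⟨ cong sumP (map-id (unitary-divisors-in d (divisors a))) ⟨
  sumP (map (λ e → e) (unitary-divisors-in d (divisors a)))
    ≡⟨ sumP-filterᵇ (λ e → e) (λ e → unitaryᵇ e d) (divisors a) ⟩
  sumP (map (λ e → if unitaryᵇ e d then e else []) (divisors a)) ∎
  where open ≡-Reasoning

sumP-σ*-divisors : ∀ {a s} → SquareFree s → a ≃ (s ⊗ s) → sumP (map σ* (divisors a)) ≃ σ a
sumP-σ*-divisors {a} {s} s-squarefree a≃s² = begin
  sumP (map σ* V)
    ≈⟨ sumP-cong σ* _ V (λ d∈ → ≡⇒≃ (σ*-over-multiple {a} d∈)) ⟩
  sumP (map (λ d → sumP (map (λ e → if unitaryᵇ e d then e else []) V)) V)
    ≡⟨ sumP-swap _ V V ⟩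
  sumP (map (λ e → sumP (map (λ d → if unitaryᵇ e d then e else []) V)) V)
    ≡⟨ cong sumP (map-cong (λ e → sym (sumP-filterᵇ (λ _ → e) (unitaryᵇ e) V)) V) ⟩
  sumP (map (λ e → sumP (map (λ _ → e) (unitary-multiples-in e V))) V)
    ≈⟨ sumP-cong (λ e → sumP (map (λ _ → e) (unitary-multiples-in e V))) (λ e → e) V (λ {e} e∈ →
         sumP-const-odd e (unitary-multiples-in e V) (unitary-multiples-odd {s = s} s-squarefree a≃s² e∈)) ⟩
  sumP (map (λ e → e) V)
    ≡⟨ cong sumP (map-id V) ⟩
  σ a ∎
  where
  open SetoidReasoning ≃-setoid
  V = divisors a

corollary3p20 : (A : Poly) → Special A → Perfect A → A ≈ sumP (map σ* (divisors A))
corollary3p20 A (S , S-squarefree , A≈S²) perfect =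
  sym (norm-≡ (≃-trans (sumP-σ*-divisors {s = S} S-squarefree (mk≃ {A} A≈S²)) (mk≃ {σ A} {A} perfect)))
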